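{- Let $\mathcal{M}^k_*=(E_*,\mathcal{I}^k_*)$ be the extended $k$-fold union of a matroid $\mathcal{M}=(E,\mathcal{I})$, and let $(e,i)\in E_*$. Then the occupancy function $\mathrm{occ}_e$ satisfies: (1) (monotone) $\mathrm{occ}_e(S)\le\mathrm{occ}_e(T)$ for all $S\subseteq T\subseteq E_*$; (2) ($1$-Lipschitz) $\mathrm{occ}_e(S\cup\{a\})-\mathrm{occ}_e(S)\le1$ for all $S\subseteq E_*$ and $a\in E_*$.
   Context: $E_*=E\times[k]$ and $\mathcal{M}_*=(E_*,\mathcal{I}_*)$ is the matroid in which $\{(e_1,i_1),\dots,(e_t,i_t)\}$ is independent iff $e_1,\dots,e_t$ are distinct and $\{e_1,\dots,e_t\}\in\mathcal{I}$ ($k$ parallel copies of each element). $\mathcal{M}^k_*$ is the $k$-fold union of $\mathcal{M}_*$: independent sets are unions of $k$ independent sets of $\mathcal{M}_*$. Let $\mathrm{rank}$ denote the rank function of $\mathcal{M}^k_*$. For $e\in E$, the occupancy function $\mathrm{occ}_e:2^{E_*}\to[0,k]$ is $\mathrm{occ}_e(S)=k-\mathrm{rank}(S\cup(\{e\}\times[k]))+\mathrm{rank}(S)$. -}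

module Defs where

open import Data.Nat using (ℕ; zero; suc; _+_; _∸_; _≤_; _<_; _⊔_)
open import Data.Bool using (Bool; true; false; if_then_else_; _∧_; _∨_)
open import Data.Fin using (Fin; combine)
open import Data.Fin.Subset using (Subset; _∈_; _∉_; _⊆_; _∪_; ⁅_⁆; ∣_∣; ⊥; inside; outside)
open import Data.Fin.Subset.Properties using (_∈?_; _⊆?_)
open import Data.Vec using (Vec; []; _∷_; tabulate; foldr)
import Data.Vec.Properties as VecP
open import Data.List using (List; []; _∷_; map; concatMap; foldr)
open import Data.Bool.ListAction using (any)
import Data.Bool
open import Data.Product using (∃; _×_; _,_)
open import Relation.Nullary using (Dec; does)
open import Relation.Binary.PropositionalEquality using (_≡_)
import Data.Fin.Properties as FinP

record Matroid (n : ℕ) : Set₁ where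
  field
    Indep      : Subset n → Set
    indep?     : (X : Subset n) → Dec (Indep X)
    indep-∅    : Indep ⊥
    indep-⊆    : ∀ {X Y} → X ⊆ Y → Indep Y → Indep X
    indep-aug  : ∀ {X Y} → Indep X → Indep Y → ∣ X ∣ < ∣ Y ∣ →
                 ∃ λ y → y ∈ Y × y ∉ X × Indep (X ∪ ⁅ y ⁆)

anyFin : ∀ {k} → (Fin k → Bool) → Bool
anyFin f = Data.Vec.foldr _ _∨_ false (tabulate f)

allFin : ∀ {k} → (Fin k → Bool) → Bool
allFin f = Data.Vec.foldr _ _∧_ true (tabulate f)

countFin : ∀ {k} → (Fin k → Bool) → ℕ
countFin f = Data.Vec.foldr _ (λ b m → (if b then 1 else 0) + m) 0 (tabulate f)

inB : ∀ {m} → Fin m → Subset m → Bool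
inB x X = does (x ∈? X)

-- E_* = E × [k], encoded as Fin (n * k) via the library bijection 'combine'.
-- (e , i) ↦ combine e i.
module Extended {n : ℕ} (M : Matroid n) (k : ℕ) where
  open Matroid M

  E* : Set
  E* = Fin (n Data.Nat.* k)

  pair : Fin n → Fin k → E*
  pair = combine

  proj : Subset (n Data.Nat.* k) → Subset n
  proj X = tabulate (λ e → if anyFin (λ i → inB (pair e i) X) then inside else outside)

  indep*B : Subset (n Data.Nat.* k) → Bool
  indep*B X = allFin (λ e → does (countFin (λ i → inB (pair e i) X) Data.Nat.≤? 1))
              ∧ does (indep? (proj X))

  allSubsets : (m : ℕ) → List (Subset m)
  allSubsets zero = [] ∷ []
  allSubsets (suc m) = concatMap (λ X → (outside ∷ X) ∷ (inside ∷ X) ∷ []) (allSubsets m)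

  tuples : ∀ {A : Set} → List A → (j : ℕ) → List (Vec A j)
  tuples xs zero = [] ∷ []
  tuples xs (suc j) = concatMap (λ x → map (x ∷_) (tuples xs j)) xs

  unionAll : ∀ {j} → Vec (Subset (n Data.Nat.* k)) j → Subset (n Data.Nat.* k)
  unionAll = Data.Vec.foldr _ _∪_ ⊥

  allV : ∀ {j} {A : Set} → (A → Bool) → Vec A j → Bool
  allV p = Data.Vec.foldr _ (λ x b → p x ∧ b) true

  indepUnionB : Subset (n Data.Nat.* k) → Bool
  indepUnionB X = any (λ Is → allV indep*B Is ∧ does (VecP.≡-dec Data.Bool._≟_ (unionAll Is) X))
                      (tuples (allSubsets (n Data.Nat.* k)) k)

  rank : Subset (n Data.Nat.* k) → ℕ
  rank S = Data.List.foldr (λ I r → (if indepUnionB I ∧ does (I ⊆? S) then ∣ I ∣ else 0) ⊔ r)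
                           0 (allSubsets (n Data.Nat.* k))

  fiber : Fin n → Subset (n Data.Nat.* k)
  fiber e = tabulate (λ x → if anyFin (λ i → does (x FinP.≟ pair e i)) then inside else outside)

  -- occ_e(S) = k - rank(S ∪ ({e}×[k])) + rank(S)
  -- (written (k + rank S) ∸ rank(...), which is exact since
  --  rank (S ∪ fiber e) ≤ rank S + k)
  occ : Fin n → Subset (n Data.Nat.* k) → ℕ
  occ e S = (k + rank S) ∸ rank (S ∪ fiber e)

{-# OPTIONS --safe #-}
module Submission where

-- Write F = {e} × [k] and r for the rank function of M^k_*, so that occ_e(S) = k + r(S) − r(S ∪ F).
-- Monotonicity of occ_e is the diminishing-returns form of submodularity,
-- r(T ∪ F) + r(S) ≤ r(S ∪ F) + r(T) for S ⊆ T, and the Lipschitz bound comes from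
-- r(S ∪ {a}) ≤ r(S) + 1 together with monotonicity of r.
-- Submodularity of r is the matroid union theorem. By Rado's theorem a set is a union of k independent
-- sets of M_* iff every subset A of it satisfies |A| ≤ k·r_*(A); and for any monotone submodular g with
-- g(∅) = 0, the sets all of whose subsets satisfy |A| ≤ g(A) are the independent sets of a matroid,
-- so r is a matroid rank function.

open import Defs
open import Data.Nat using (ℕ; zero; suc; _+_; _*_; _∸_; _≤_; _<_; _⊔_; z≤n; s≤s; s≤s⁻¹; _<?_)
open import Data.Nat.Properties hiding (_≟_)
open import Data.Bool using (Bool; true; false; T; _∧_; if_then_else_)
open import Data.Unit using (tt)
open import Data.Bool.Properties using (T-∧)
open import Data.Fin using (Fin; zero; suc; combine; _↑ˡ_; _↑ʳ_)
open import Data.Fin.Properties as Finₚ using (_≟_; any?; combine-injective)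
open import Data.Fin.Subset
  using (Subset; _∈_; _∉_; _⊆_; _∪_; _∩_; _─_; _-_; ⁅_⁆; ∣_∣; ⊥; ⊤; Nonempty; Empty; inside; outside)
open import Data.Fin.Subset.Properties
open import Data.Vec using (Vec; []; _∷_; lookup; tabulate; here; there)
open import Data.Vec.Properties using (lookup∘tabulate)
import Data.Vec.Properties as Vecₚ
import Data.Bool.Properties as Boolₚ
open import Data.Product using (∃; _×_; _,_; proj₁; proj₂)
open import Data.Sum using (_⊎_; inj₁; inj₂; [_,_]′)
open import Data.List using (List; []; _∷_; foldr)
open import Data.List.Membership.Propositional using (lose) renaming (_∈_ to _∈ₗ_)
import Data.List.Relation.Unary.Any as Any
open import Data.List.Relation.Unary.Any.Properties using (any⁺; any⁻)
open import Data.List.Membership.Propositional.Properties using (∈-map⁺; ∈-concatMap⁺)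
open import Function.Properties.Equivalence using () renaming (trans to ⇔-trans)
open import Algebra.Properties.CommutativeSemigroup +-commutativeSemigroup using (x∙yz≈y∙xz)
open import Data.Empty using (⊥-elim)
open import Function using (_∘_; id; _⇔_; mk⇔; Equivalence)
open Equivalence using (to; from)
open import Relation.Nullary using (Dec; yes; no; does; ¬_; ¬?; contradiction; _×-dec_)
open import Relation.Nullary.Decidable using (toSum; decidable-stable; T?)
import Relation.Nullary.Decidable as Decidable
open import Induction.WellFounded using (Acc; acc)
open import Data.Nat.Induction using (<-wellFounded)
open import Relation.Binary.PropositionalEquality
  using (_≡_; _≢_; refl; sym; trans; cong; cong₂; subst; subst₂; module ≡-Reasoning)
open import Algebra.Properties.CommutativeMonoid.Sum +-0-commutativeMonoid
  using (sum; ∑-distrib-+; sum-cong-≗; sum-replicate-zero)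

∪-least : ∀ {m} {p q r : Subset m} → p ⊆ r → q ⊆ r → p ∪ q ⊆ r
∪-least p⊆r q⊆r x∈p∪q = [ p⊆r , q⊆r ]′ (x∈p∪q⁻ _ _ x∈p∪q)

∩-greatest : ∀ {m} {p q r : Subset m} → p ⊆ q → p ⊆ r → p ⊆ q ∩ r
∩-greatest p⊆q p⊆r x∈p = x∈p∩q⁺ (p⊆q x∈p , p⊆r x∈p)

∣p∪q∣+∣p∩q∣≡∣p∣+∣q∣ : ∀ {m} (p q : Subset m) → ∣ p ∪ q ∣ + ∣ p ∩ q ∣ ≡ ∣ p ∣ + ∣ q ∣
∣p∪q∣+∣p∩q∣≡∣p∣+∣q∣ []            []            = refl
∣p∪q∣+∣p∩q∣≡∣p∣+∣q∣ (inside  ∷ p) (inside  ∷ q) =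
  cong suc (trans (+-suc _ _) (trans (cong suc (∣p∪q∣+∣p∩q∣≡∣p∣+∣q∣ p q)) (sym (+-suc _ _))))
∣p∪q∣+∣p∩q∣≡∣p∣+∣q∣ (inside  ∷ p) (outside ∷ q) = cong suc (∣p∪q∣+∣p∩q∣≡∣p∣+∣q∣ p q)
∣p∪q∣+∣p∩q∣≡∣p∣+∣q∣ (outside ∷ p) (inside  ∷ q) =
  trans (cong suc (∣p∪q∣+∣p∩q∣≡∣p∣+∣q∣ p q)) (sym (+-suc _ _))
∣p∪q∣+∣p∩q∣≡∣p∣+∣q∣ (outside ∷ p) (outside ∷ q) = ∣p∪q∣+∣p∩q∣≡∣p∣+∣q∣ p q

∣p∪q∣≤∣p∣+∣q∣ : ∀ {m} (p q : Subset m) → ∣ p ∪ q ∣ ≤ ∣ p ∣ + ∣ q ∣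
∣p∪q∣≤∣p∣+∣q∣ p q = subst (∣ p ∪ q ∣ ≤_) (∣p∪q∣+∣p∩q∣≡∣p∣+∣q∣ p q) (m≤m+n _ _)

Empty⇒∣p∣≡0 : ∀ {m} {p : Subset m} → Empty p → ∣ p ∣ ≡ 0
Empty⇒∣p∣≡0 {m} p-empty = trans (cong ∣_∣ (Empty-unique p-empty)) (∣⊥∣≡0 m)

∣p∣≡0⇒Empty : ∀ {m} {p : Subset m} → ∣ p ∣ ≡ 0 → Empty p
∣p∣≡0⇒Empty ∣p∣≡0 (x , x∈p) = contradiction ∣p∣≡0 (>⇒≢ (≤-trans (s≤s z≤n) (x∈p⇒∣p-x∣<∣p∣ x∈p)))

0<∣p∣⇒Nonempty : ∀ {m} (p : Subset m) → 0 < ∣ p ∣ → Nonempty p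
0<∣p∣⇒Nonempty p 0<∣p∣ with nonempty? p
... | yes p≢∅ = p≢∅
... | no  p-empty = contradiction (Empty⇒∣p∣≡0 p-empty) (>⇒≢ 0<∣p∣)

Empty[p∩q]⇒∣p∪q∣≡∣p∣+∣q∣ : ∀ {m} (p q : Subset m) → Empty (p ∩ q) → ∣ p ∪ q ∣ ≡ ∣ p ∣ + ∣ q ∣
Empty[p∩q]⇒∣p∪q∣≡∣p∣+∣q∣ p q disjoint = begin
  ∣ p ∪ q ∣                 ≡⟨ +-identityʳ _ ⟨
  ∣ p ∪ q ∣ + 0             ≡⟨ cong (∣ p ∪ q ∣ +_) (Empty⇒∣p∣≡0 disjoint) ⟨
  ∣ p ∪ q ∣ + ∣ p ∩ q ∣     ≡⟨ ∣p∪q∣+∣p∩q∣≡∣p∣+∣q∣ p q ⟩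
  ∣ p ∣ + ∣ q ∣             ∎
  where open ≡-Reasoning

x∉p⇒∣p∪⁅x⁆∣≡1+∣p∣ : ∀ {m} {x : Fin m} (p : Subset m) → x ∉ p → ∣ p ∪ ⁅ x ⁆ ∣ ≡ suc ∣ p ∣
x∉p⇒∣p∪⁅x⁆∣≡1+∣p∣ {x = x} p x∉p = begin
  ∣ p ∪ ⁅ x ⁆ ∣       ≡⟨ Empty[p∩q]⇒∣p∪q∣≡∣p∣+∣q∣ p ⁅ x ⁆ disjoint ⟩
  ∣ p ∣ + ∣ ⁅ x ⁆ ∣   ≡⟨ cong (∣ p ∣ +_) (∣⁅x⁆∣≡1 x) ⟩
  ∣ p ∣ + 1           ≡⟨ +-comm _ 1 ⟩
  suc ∣ p ∣           ∎
  where
  open ≡-Reasoning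
  disjoint : Empty (p ∩ ⁅ x ⁆)
  disjoint (y , y∈p∩x) with x∈p∩q⁻ p ⁅ x ⁆ y∈p∩x
  ... | y∈p , y∈⁅x⁆ = x∉p (subst (_∈ p) (x∈⁅y⁆⇒x≡y x y∈⁅x⁆) y∈p)

x∈p─q⇒x∉q : ∀ {m} {x : Fin m} (p q : Subset m) → x ∈ p ─ q → x ∉ q
x∈p─q⇒x∉q (_ ∷ p) (inside ∷ q) () here
x∈p─q⇒x∉q (_ ∷ p) (_      ∷ q) (there x∈p─q) (there x∈q) = x∈p─q⇒x∉q p q x∈p─q x∈q

x∈p⇒⁅x⁆⊆p : ∀ {m} {x : Fin m} {p : Subset m} → x ∈ p → ⁅ x ⁆ ⊆ p
x∈p⇒⁅x⁆⊆p {x = x} {p} x∈p y∈⁅x⁆ = subst (_∈ p) (sym (x∈⁅y⁆⇒x≡y x y∈⁅x⁆)) x∈p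

p⊆[p-x]∪⁅x⁆ : ∀ {m} (p : Subset m) (x : Fin m) → p ⊆ (p - x) ∪ ⁅ x ⁆
p⊆[p-x]∪⁅x⁆ p x {y} y∈p with y ≟ x
... | yes refl = q⊆p∪q _ _ (x∈⁅x⁆ x)
... | no  y≢x  = p⊆p∪q _ (x∈p∧x≢y⇒x∈p-y y∈p y≢x)

∣p∣≤1+∣p-x∣ : ∀ {m} (p : Subset m) (x : Fin m) → ∣ p ∣ ≤ suc ∣ p - x ∣
∣p∣≤1+∣p-x∣ p x = begin
  ∣ p ∣                    ≤⟨ p⊆q⇒∣p∣≤∣q∣ (p⊆[p-x]∪⁅x⁆ p x) ⟩
  ∣ (p - x) ∪ ⁅ x ⁆ ∣      ≤⟨ ∣p∪q∣≤∣p∣+∣q∣ (p - x) ⁅ x ⁆ ⟩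
  ∣ p - x ∣ + ∣ ⁅ x ⁆ ∣    ≡⟨ cong (∣ p - x ∣ +_) (∣⁅x⁆∣≡1 x) ⟩
  ∣ p - x ∣ + 1            ≡⟨ +-comm _ 1 ⟩
  suc ∣ p - x ∣            ∎
  where open ≤-Reasoning

x∈p⇒∣p∣≡1+∣p-x∣ : ∀ {m} {x : Fin m} {p : Subset m} → x ∈ p → ∣ p ∣ ≡ suc ∣ p - x ∣
x∈p⇒∣p∣≡1+∣p-x∣ {x = x} {p} x∈p = ≤-antisym (∣p∣≤1+∣p-x∣ p x) (x∈p⇒∣p-x∣<∣p∣ x∈p)

subset-induction : ∀ {m} (P : Subset m → Set) → P ⊥ → (∀ Z x → P Z → P (Z ∪ ⁅ x ⁆)) → ∀ Z → P Z
subset-induction P P⊥ P-insert Z = go ∣ Z ∣ Z refl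
  where
  go : ∀ s Z → ∣ Z ∣ ≡ s → P Z
  go zero    Z ∣Z∣≡0 = subst P (sym (Empty-unique (∣p∣≡0⇒Empty ∣Z∣≡0))) P⊥
  go (suc s) Z ∣Z∣≡1+s with 0<∣p∣⇒Nonempty Z (subst (0 <_) (sym ∣Z∣≡1+s) (s≤s z≤n))
  ... | x , x∈Z = subst P (⊆-antisym (∪-least (p─q⊆p Z ⁅ x ⁆) (x∈p⇒⁅x⁆⊆p x∈Z)) (p⊆[p-x]∪⁅x⁆ Z x))
                    (P-insert (Z - x) x (go s (Z - x) (suc-injective (trans (sym (x∈p⇒∣p∣≡1+∣p-x∣ x∈Z)) ∣Z∣≡1+s))))

sum-mono-≤ : ∀ {k} {f g : Fin k → ℕ} → (∀ j → f j ≤ g j) → sum f ≤ sum g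
sum-mono-≤ {zero}  f≤g = z≤n
sum-mono-≤ {suc k} f≤g = +-mono-≤ (f≤g zero) (sum-mono-≤ (f≤g ∘ suc))

sum-mono-< : ∀ {k} {f g : Fin k → ℕ} → (∀ j → f j ≤ g j) → ∀ j → f j < g j → sum f < sum g
sum-mono-< {suc k} f≤g zero    f0<g0 = +-mono-<-≤ f0<g0 (sum-mono-≤ (f≤g ∘ suc))
sum-mono-< {suc k} f≤g (suc j) fj<gj = +-mono-≤-< (f≤g zero) (sum-mono-< (f≤g ∘ suc) j fj<gj)

0<sum⇒∃0<term : ∀ {k} (f : Fin k → ℕ) → 0 < sum f → ∃ λ j → 0 < f j
0<sum⇒∃0<term {suc k} f 0<sum with f zero in f0≡
... | suc _ = zero , subst (0 <_) (sym f0≡) (s≤s z≤n)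
... | zero with 0<sum⇒∃0<term (f ∘ suc) 0<sum
...   | j , 0<fj = suc j , 0<fj

sum-single : ∀ {k} (f : Fin k → ℕ) j → (∀ i → i ≢ j → f i ≡ 0) → sum f ≡ f j
sum-single {suc k} f zero others-zero = begin
  f zero + sum (f ∘ suc)          ≡⟨ cong (f zero +_) (sum-cong-≗ (λ i → others-zero (suc i) (λ ()))) ⟩
  f zero + sum {k} (λ _ → 0)      ≡⟨ cong (f zero +_) (sum-replicate-zero k) ⟩
  f zero + 0                      ≡⟨ +-identityʳ _ ⟩
  f zero                          ∎
  where open ≡-Reasoning
sum-single {suc k} f (suc j) others-zero rewrite others-zero zero (λ ()) =
  sum-single (f ∘ suc) j (λ i i≢j → others-zero (suc i) (i≢j ∘ Finₚ.suc-injective))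

∣p∣≤∑∣p∩Cj∣ : ∀ {m k} (p : Subset m) (C : Fin k → Subset m) → (∀ {x} → x ∈ p → ∃ λ j → x ∈ C j) →
             ∣ p ∣ ≤ sum (λ j → ∣ p ∩ C j ∣)
∣p∣≤∑∣p∩Cj∣ {k = zero}  p C covered = ≤-reflexive (Empty⇒∣p∣≡0 (λ (_ , x∈p) → Finₚ.¬Fin0 (proj₁ (covered x∈p))))
∣p∣≤∑∣p∩Cj∣ {k = suc k} p C covered = begin
  ∣ p ∣                                              ≤⟨ p⊆q⇒∣p∣≤∣q∣ p⊆ ⟩
  ∣ (p ∩ C zero) ∪ (p ─ C zero) ∣                    ≤⟨ ∣p∪q∣≤∣p∣+∣q∣ (p ∩ C zero) (p ─ C zero) ⟩
  ∣ p ∩ C zero ∣ + ∣ p ─ C zero ∣                    ≤⟨ +-monoʳ-≤ ∣ p ∩ C zero ∣ (∣p∣≤∑∣p∩Cj∣ _ (C ∘ suc) covered′) ⟩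
  ∣ p ∩ C zero ∣ + sum (λ j → ∣ (p ─ C zero) ∩ C (suc j) ∣)
      ≤⟨ +-monoʳ-≤ ∣ p ∩ C zero ∣ (sum-mono-≤ {k} (p⊆q⇒∣p∣≤∣q∣ ∘ p─C₀∩Cj⊆p∩Cj)) ⟩
  ∣ p ∩ C zero ∣ + sum (λ j → ∣ p ∩ C (suc j) ∣)     ∎
  where
  open ≤-Reasoning
  p─C₀∩Cj⊆p∩Cj : ∀ j → (p ─ C zero) ∩ C (suc j) ⊆ p ∩ C (suc j)
  p─C₀∩Cj⊆p∩Cj j = ∩-greatest (⊆-trans (p∩q⊆p _ _) (p─q⊆p p (C zero))) (p∩q⊆q _ _)
  p⊆ : p ⊆ (p ∩ C zero) ∪ (p ─ C zero)
  p⊆ {x} x∈p with x ∈? C zero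
  ... | yes x∈C₀ = p⊆p∪q _ (x∈p∩q⁺ (x∈p , x∈C₀))
  ... | no  x∉C₀ = q⊆p∪q _ _ (x∈p∧x∉q⇒x∈p─q x∈p x∉C₀)
  covered′ : ∀ {x} → x ∈ p ─ C zero → ∃ λ j → x ∈ C (suc j)
  covered′ x∈p─C₀ with covered (p─q⊆p p (C zero) x∈p─C₀)
  ... | zero  , x∈C₀ = contradiction x∈C₀ (x∈p─q⇒x∉q p (C zero) x∈p─C₀)
  ... | suc j , x∈Cj = j , x∈Cj

-- Submodular functions and matroid rank

Monotone : ∀ {m} → (Subset m → ℕ) → Set
Monotone g = ∀ {A B} → A ⊆ B → g A ≤ g B

Submodular : ∀ {m} → (Subset m → ℕ) → Set
Submodular g = ∀ A B → g (A ∪ B) + g (A ∩ B) ≤ g A + g B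

Spans : ∀ {m} → (Subset m → ℕ) → Subset m → Subset m → Set
Spans g T Z = g (T ∪ Z) ≤ g T

module _ {m} {g : Subset m → ℕ} (g-mono : Monotone g) (g-submodular : Submodular g) where

  submodular-⊆ : ∀ {A B U C} → U ⊆ A ∪ B → C ⊆ A ∩ B → g U + g C ≤ g A + g B
  submodular-⊆ U⊆A∪B C⊆A∩B = ≤-trans (+-mono-≤ (g-mono U⊆A∪B) (g-mono C⊆A∩B)) (g-submodular _ _)

  spans-⊆ : ∀ {T T′ Z} → T ⊆ T′ → Spans g T Z → Spans g T′ Z
  spans-⊆ {T} {T′} {Z} T⊆T′ T-spans = +-cancelʳ-≤ (g T) _ _ (begin
    g (T′ ∪ Z) + g T   ≤⟨ submodular-⊆ (∪-least (q⊆p∪q _ T′) (⊆-trans (q⊆p∪q T Z) (p⊆p∪q T′)))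
                                       (∩-greatest (p⊆p∪q Z) T⊆T′) ⟩
    g (T ∪ Z) + g T′   ≤⟨ +-monoˡ-≤ (g T′) T-spans ⟩
    g T + g T′         ≡⟨ +-comm (g T) (g T′) ⟩
    g T′ + g T         ∎)
    where open ≤-Reasoning

  spans-∪ : ∀ {T Z₁ Z₂} → Spans g T Z₁ → Spans g T Z₂ → Spans g T (Z₁ ∪ Z₂)
  spans-∪ {T} {Z₁} {Z₂} spans₁ spans₂ = +-cancelʳ-≤ (g T) _ _ (begin
    g (T ∪ (Z₁ ∪ Z₂)) + g T   ≤⟨ submodular-⊆ T∪Z₁∪Z₂⊆ (∩-greatest (p⊆p∪q Z₁) (p⊆p∪q Z₂)) ⟩
    g (T ∪ Z₁) + g (T ∪ Z₂)   ≤⟨ +-mono-≤ spans₁ spans₂ ⟩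
    g T + g T                 ∎)
    where
    open ≤-Reasoning
    T∪Z₁∪Z₂⊆ : T ∪ (Z₁ ∪ Z₂) ⊆ (T ∪ Z₁) ∪ (T ∪ Z₂)
    T∪Z₁∪Z₂⊆ = ∪-least (⊆-trans (p⊆p∪q Z₁) (p⊆p∪q _))
                 (∪-least (⊆-trans (q⊆p∪q T Z₁) (p⊆p∪q _)) (⊆-trans (q⊆p∪q T Z₂) (q⊆p∪q _ _)))

record IsRankFunction {m} (Indep : Subset m → Set) (ρ : Subset m → ℕ) : Set where
  field
    indep⇒≤rank   : ∀ {I S} → Indep I → I ⊆ S → ∣ I ∣ ≤ ρ S
    rank-attained : ∀ S → ∃ λ I → Indep I × I ⊆ S × ∣ I ∣ ≡ ρ S

maxSize : ∀ {m} → (Subset m → Bool) → List (Subset m) → Subset m → ℕ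
maxSize p Xs S = foldr (λ I r → (if p I ∧ does (I ⊆? S) then ∣ I ∣ else 0) ⊔ r) 0 Xs

module _ {m} {P : Subset m → Set} {p : Subset m → Bool} (p-reflects : ∀ X → T (p X) ⇔ P X) where

  maxSize-bound : ∀ {Xs I S} → P I → I ⊆ S → I ∈ₗ Xs → ∣ I ∣ ≤ maxSize p Xs S
  maxSize-bound {I ∷ Xs} {I} {S} P-I I⊆S (Any.here refl)
    with p I | from (p-reflects I) P-I | I ⊆? S
  ... | true | _ | yes _   = m≤m⊔n _ _
  ... | true | _ | no I⊈S = ⊥-elim (I⊈S I⊆S)
  maxSize-bound {X ∷ Xs} P-I I⊆S (Any.there I∈Xs) = ≤-trans (maxSize-bound P-I I⊆S I∈Xs) (m≤n⊔m _ _)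

  maxSize-attained : ∀ Xs S → maxSize p Xs S ≡ 0 ⊎ ∃ λ I → P I × I ⊆ S × ∣ I ∣ ≡ maxSize p Xs S
  maxSize-attained []       S = inj₁ refl
  maxSize-attained (I ∷ Xs) S with p I in p-I | I ⊆? S
  ... | false | _       = maxSize-attained Xs S
  ... | true  | no _    = maxSize-attained Xs S
  ... | true  | yes I⊆S with ≤-total ∣ I ∣ (maxSize p Xs S)
  ...   | inj₁ ∣I∣≤ rewrite m≤n⇒m⊔n≡n ∣I∣≤ = maxSize-attained Xs S
  ...   | inj₂ ≤∣I∣ rewrite m≥n⇒m⊔n≡m ≤∣I∣ =
          inj₂ (I , to (p-reflects I) (subst T (sym p-I) tt) , I⊆S , refl)

  maxSize-isRank : ∀ {Xs} → P ⊥ → (∀ X → X ∈ₗ Xs) → IsRankFunction P (maxSize p Xs)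
  maxSize-isRank {Xs} P-⊥ complete = record
    { indep⇒≤rank   = λ P-I I⊆S → maxSize-bound P-I I⊆S (complete _)
    ; rank-attained = attained
    }
    where
    attained : ∀ S → ∃ λ I → P I × I ⊆ S × ∣ I ∣ ≡ maxSize p Xs S
    attained S with maxSize-attained Xs S
    ... | inj₁ ≡0 = ⊥ , P-⊥ , ⊥-elim ∘ ∉⊥ , trans (∣⊥∣≡0 m) (sym ≡0)
    ... | inj₂ I  = I

module MatroidRank {m} (M : Matroid m) {ρ : Subset m → ℕ} (isRank : IsRankFunction (Matroid.Indep M) ρ) where
  open Matroid M
  open IsRankFunction isRank

  rank-mono : Monotone ρ
  rank-mono {S} {S′} S⊆S′ with rank-attained S
  ... | I , I-indep , I⊆S , ∣I∣≡ρS = subst (_≤ ρ S′) ∣I∣≡ρS (indep⇒≤rank I-indep (⊆-trans I⊆S S⊆S′))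

  rank≤∣S∣ : ∀ S → ρ S ≤ ∣ S ∣
  rank≤∣S∣ S with rank-attained S
  ... | I , _ , I⊆S , ∣I∣≡ρS = subst (_≤ ∣ S ∣) ∣I∣≡ρS (p⊆q⇒∣p∣≤∣q∣ I⊆S)

  rank-⊥ : ρ ⊥ ≡ 0
  rank-⊥ = n≤0⇒n≡0 (subst (ρ ⊥ ≤_) (∣⊥∣≡0 m) (rank≤∣S∣ ⊥))

  rank-∪⁅x⁆ : ∀ S x → ρ (S ∪ ⁅ x ⁆) ≤ suc (ρ S)
  rank-∪⁅x⁆ S x with rank-attained (S ∪ ⁅ x ⁆)
  ... | I , I-indep , I⊆S∪x , ∣I∣≡ = subst (_≤ suc (ρ S)) ∣I∣≡
        (≤-trans (∣p∣≤1+∣p-x∣ I x) (s≤s (indep⇒≤rank (indep-⊆ (p─q⊆p I ⁅ x ⁆) I-indep) I-x⊆S)))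
    where
    I-x⊆S : I - x ⊆ S
    I-x⊆S y∈I-x with x∈p∪q⁻ S ⁅ x ⁆ (I⊆S∪x (p─q⊆p I ⁅ x ⁆ y∈I-x))
    ... | inj₁ y∈S   = y∈S
    ... | inj₂ y∈⁅x⁆ = contradiction y∈⁅x⁆ (x∈p─q⇒x∉q I ⁅ x ⁆ y∈I-x)

  ∣S∣≤rank⇒indep : ∀ {S} → ∣ S ∣ ≤ ρ S → Indep S
  ∣S∣≤rank⇒indep {S} ∣S∣≤ρS with rank-attained S
  ... | I , I-indep , I⊆S , ∣I∣≡ρS = indep-⊆ S⊆I I-indep
    where
    S⊆I : S ⊆ I
    S⊆I {x} x∈S with x ∈? I
    ... | yes x∈I = x∈I
    ... | no  x∉I = contradiction (p⊂q⇒∣p∣<∣q∣ (I⊆S , x , x∈S , x∉I)) (≤⇒≯ (subst (∣ S ∣ ≤_) (sym ∣I∣≡ρS) ∣S∣≤ρS))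

  basis-extension : ∀ {I Z} → Indep I → I ⊆ Z → ∃ λ B → Indep B × I ⊆ B × B ⊆ Z × ∣ B ∣ ≡ ρ Z
  basis-extension {I} {Z} I-indep I⊆Z =
    extend (ρ Z ∸ ∣ I ∣) I-indep I⊆Z (sym (m∸n+n≡m (indep⇒≤rank I-indep I⊆Z)))
    where
    extend : ∀ gap {I} → Indep I → I ⊆ Z → ρ Z ≡ gap + ∣ I ∣ →
             ∃ λ B → Indep B × I ⊆ B × B ⊆ Z × ∣ B ∣ ≡ ρ Z
    extend zero      {I} I-indep I⊆Z ρZ≡ = I , I-indep , id , I⊆Z , sym ρZ≡
    extend (suc gap) {I} I-indep I⊆Z ρZ≡ with rank-attained Z
    ... | B₀ , B₀-indep , B₀⊆Z , ∣B₀∣≡ρZ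
      with indep-aug I-indep B₀-indep (subst (∣ I ∣ <_) (trans (sym ρZ≡) (sym ∣B₀∣≡ρZ)) (m<n+m ∣ I ∣ (s≤s z≤n)))
    ... | y , y∈B₀ , y∉I , I+y-indep
      with extend gap I+y-indep (∪-least I⊆Z (x∈p⇒⁅x⁆⊆p (B₀⊆Z y∈B₀)))
                  (trans ρZ≡ (trans (sym (+-suc gap ∣ I ∣)) (cong (gap +_) (sym (x∉p⇒∣p∪⁅x⁆∣≡1+∣p∣ I y∉I)))))
    ... | B , B-indep , I+y⊆B , B⊆Z , ∣B∣≡ρZ = B , B-indep , ⊆-trans (p⊆p∪q ⁅ y ⁆) I+y⊆B , B⊆Z , ∣B∣≡ρZ

  rank-submodular : Submodular ρ
  rank-submodular A B with rank-attained (A ∩ B)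
  ... | D₀ , D₀-indep , D₀⊆A∩B , ∣D₀∣≡
    with basis-extension D₀-indep (⊆-trans D₀⊆A∩B (⊆-trans (p∩q⊆p A B) (p⊆p∪q B)))
  ... | D , D-indep , D₀⊆D , D⊆A∪B , ∣D∣≡ = begin
    ρ (A ∪ B) + ρ (A ∩ B)                          ≡⟨ cong₂ _+_ ∣D∣≡ ∣D₀∣≡ ⟨
    ∣ D ∣ + ∣ D₀ ∣                                  ≤⟨ +-mono-≤ (p⊆q⇒∣p∣≤∣q∣ D⊆DA∪DB) (p⊆q⇒∣p∣≤∣q∣ D₀⊆DA∩DB) ⟩
    ∣ (D ∩ A) ∪ (D ∩ B) ∣ + ∣ (D ∩ A) ∩ (D ∩ B) ∣   ≡⟨ ∣p∪q∣+∣p∩q∣≡∣p∣+∣q∣ (D ∩ A) (D ∩ B) ⟩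
    ∣ D ∩ A ∣ + ∣ D ∩ B ∣                           ≤⟨ +-mono-≤ (part A) (part B) ⟩
    ρ A + ρ B                                       ∎
    where
    open ≤-Reasoning
    part : ∀ X → ∣ D ∩ X ∣ ≤ ρ X
    part X = indep⇒≤rank (indep-⊆ (p∩q⊆p D X) D-indep) (p∩q⊆q D X)
    D⊆DA∪DB : D ⊆ (D ∩ A) ∪ (D ∩ B)
    D⊆DA∪DB x∈D = x∈p∪q⁺ (Data.Sum.map (λ x∈A → x∈p∩q⁺ (x∈D , x∈A)) (λ x∈B → x∈p∩q⁺ (x∈D , x∈B))
                                         (x∈p∪q⁻ A B (D⊆A∪B x∈D)))
    D₀⊆DA∩DB : D₀ ⊆ (D ∩ A) ∩ (D ∩ B)
    D₀⊆DA∩DB = ∩-greatest (∩-greatest D₀⊆D (⊆-trans D₀⊆A∩B (p∩q⊆p A B)))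
                          (∩-greatest D₀⊆D (⊆-trans D₀⊆A∩B (p∩q⊆q A B)))

-- The matroid of a monotone submodular function

Hall : ∀ {m} → (Subset m → ℕ) → Subset m → Set
Hall g I = ∀ A → A ⊆ I → ∣ A ∣ ≤ g A

Violator : ∀ {m} → (Subset m → ℕ) → Subset m → Set
Violator g I = ∃ λ A → A ⊆ I × g A < ∣ A ∣

module _ {m} (g : Subset m → ℕ) where

  hall-or-violator : ∀ I → Hall g I ⊎ Violator g I
  hall-or-violator I with anySubset? (λ A → (A ⊆? I) ×-dec (g A <? ∣ A ∣))
  ... | yes violator  = inj₂ violator
  ... | no ¬violator = inj₁ (λ A A⊆I → ≮⇒≥ (λ gA<∣A∣ → ¬violator (A , A⊆I , gA<∣A∣)))

  hall? : ∀ I → Dec (Hall g I)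
  hall? I = [ yes , (λ (A , A⊆I , gA<∣A∣) → no (λ hall → <⇒≱ gA<∣A∣ (hall A A⊆I))) ]′ (hall-or-violator I)

  hall-⊆ : ∀ {X Y} → X ⊆ Y → Hall g Y → Hall g X
  hall-⊆ X⊆Y Y-hall A A⊆X = Y-hall A (⊆-trans A⊆X X⊆Y)

  hall-⊥ : Hall g ⊥
  hall-⊥ A A⊆⊥ = ≤-trans (p⊆q⇒∣p∣≤∣q∣ A⊆⊥) (≤-trans (≤-reflexive (∣⊥∣≡0 m)) z≤n)

module HallMatroid {m} (g : Subset m → ℕ) (g-mono : Monotone g) (g-submodular : Submodular g)
                   (g-⊥ : g ⊥ ≡ 0) where

  module Augmentation {I : Subset m} (I-hall : Hall g I) where

    Tight : Subset m → Set
    Tight T = T ⊆ I × g T ≤ ∣ T ∣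

    tight-∪ : ∀ {T₁ T₂} → Tight T₁ → Tight T₂ → Tight (T₁ ∪ T₂)
    tight-∪ {T₁} {T₂} (T₁⊆I , T₁-tight) (T₂⊆I , T₂-tight) = ∪-least T₁⊆I T₂⊆I ,
      +-cancelʳ-≤ (g (T₁ ∩ T₂)) _ _ (begin
        g (T₁ ∪ T₂) + g (T₁ ∩ T₂)   ≤⟨ g-submodular T₁ T₂ ⟩
        g T₁ + g T₂                 ≤⟨ +-mono-≤ T₁-tight T₂-tight ⟩
        ∣ T₁ ∣ + ∣ T₂ ∣             ≡⟨ ∣p∪q∣+∣p∩q∣≡∣p∣+∣q∣ T₁ T₂ ⟨
        ∣ T₁ ∪ T₂ ∣ + ∣ T₁ ∩ T₂ ∣   ≤⟨ +-monoʳ-≤ ∣ T₁ ∪ T₂ ∣ (I-hall _ (⊆-trans (p∩q⊆p T₁ T₂) T₁⊆I)) ⟩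
        ∣ T₁ ∪ T₂ ∣ + g (T₁ ∩ T₂)   ∎)
      where open ≤-Reasoning

    violator-tight : ∀ {x A} → A ⊆ I ∪ ⁅ x ⁆ → g A < ∣ A ∣ → Tight (A - x) × Spans g (A - x) ⁅ x ⁆
    violator-tight {x} {A} A⊆I+x gA<∣A∣ = (A-x⊆I , ≤-trans (g-mono (p─q⊆p A ⁅ x ⁆)) gA≤∣A-x∣) ,
      (begin
        g ((A - x) ∪ ⁅ x ⁆)   ≤⟨ g-mono (∪-least (p─q⊆p A ⁅ x ⁆) (x∈p⇒⁅x⁆⊆p x∈A)) ⟩
        g A                   ≤⟨ gA≤∣A-x∣ ⟩
        ∣ A - x ∣             ≤⟨ I-hall (A - x) A-x⊆I ⟩
        g (A - x)             ∎)
      where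
      open ≤-Reasoning
      x∈A : x ∈ A
      x∈A with x ∈? A
      ... | yes x∈A = x∈A
      ... | no  x∉A = contradiction (I-hall A A⊆I) (<⇒≱ gA<∣A∣)
        where
        A⊆I : A ⊆ I
        A⊆I y∈A = [ id , (λ y∈⁅x⁆ → contradiction (subst (_∈ A) (x∈⁅y⁆⇒x≡y _ y∈⁅x⁆) y∈A) x∉A) ]′
                    (x∈p∪q⁻ I ⁅ x ⁆ (A⊆I+x y∈A))
      A-x⊆I : A - x ⊆ I
      A-x⊆I y∈A-x = [ id , (λ y∈⁅x⁆ → contradiction y∈⁅x⁆ (x∈p─q⇒x∉q A ⁅ x ⁆ y∈A-x)) ]′
                      (x∈p∪q⁻ I ⁅ x ⁆ (A⊆I+x (p─q⊆p A ⁅ x ⁆ y∈A-x)))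
      gA≤∣A-x∣ : g A ≤ ∣ A - x ∣
      gA≤∣A-x∣ = s≤s⁻¹ (subst (g A <_) (x∈p⇒∣p∣≡1+∣p-x∣ x∈A) gA<∣A∣)

    tight-spanning : ∀ {Z₀} → (∀ y → y ∈ Z₀ → Violator g (I ∪ ⁅ y ⁆)) →
                     ∀ Z → Z ⊆ Z₀ → ∃ λ T → Tight T × Spans g T Z
    tight-spanning {Z₀} violators = subset-induction _ base step
      where
      base : ⊥ ⊆ Z₀ → ∃ λ T → Tight T × Spans g T ⊥
      base _ = ⊥ , (⊥-elim ∘ ∉⊥ , ≤-reflexive (trans g-⊥ (sym (∣⊥∣≡0 m)))) , ≤-reflexive (cong g (∪-identityˡ ⊥))
      step : ∀ Z x → (Z ⊆ Z₀ → ∃ λ T → Tight T × Spans g T Z) →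
             Z ∪ ⁅ x ⁆ ⊆ Z₀ → ∃ λ T → Tight T × Spans g T (Z ∪ ⁅ x ⁆)
      step Z x Z-spanned Z+x⊆Z₀
        with Z-spanned (⊆-trans (p⊆p∪q _) Z+x⊆Z₀) | violators x (Z+x⊆Z₀ (q⊆p∪q Z _ (x∈⁅x⁆ x)))
      ... | T , T-tight , T-spans | A , A⊆I+x , gA<∣A∣ with violator-tight A⊆I+x gA<∣A∣
      ... | A-x-tight , A-x-spans = T ∪ (A - x) , tight-∪ T-tight A-x-tight ,
            spans-∪ g-mono g-submodular (spans-⊆ g-mono g-submodular (p⊆p∪q _) T-spans)
                                        (spans-⊆ g-mono g-submodular (q⊆p∪q T _) A-x-spans)

    ∣J∣≤∣I∣ : ∀ {J} → Hall g J → (∃ λ T → Tight T × Spans g T (J ─ I)) → ∣ J ∣ ≤ ∣ I ∣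
    ∣J∣≤∣I∣ {J} J-hall (T , (T⊆I , T-tight) , T-spans) = begin
      ∣ J ∣                              ≤⟨ p⊆q⇒∣p∣≤∣q∣ J⊆ ⟩
      ∣ (J ∩ (T ∪ Z)) ∪ (I ─ T) ∣        ≤⟨ ∣p∪q∣≤∣p∣+∣q∣ (J ∩ (T ∪ Z)) (I ─ T) ⟩
      ∣ J ∩ (T ∪ Z) ∣ + ∣ I ─ T ∣        ≤⟨ +-monoˡ-≤ ∣ I ─ T ∣ (J-hall _ (p∩q⊆p J _)) ⟩
      g (J ∩ (T ∪ Z)) + ∣ I ─ T ∣        ≤⟨ +-monoˡ-≤ ∣ I ─ T ∣ (g-mono (p∩q⊆q J _)) ⟩
      g (T ∪ Z) + ∣ I ─ T ∣              ≤⟨ +-monoˡ-≤ ∣ I ─ T ∣ (≤-trans T-spans T-tight) ⟩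
      ∣ T ∣ + ∣ I ─ T ∣                  ≡⟨ Empty[p∩q]⇒∣p∪q∣≡∣p∣+∣q∣ T (I ─ T) disjoint ⟨
      ∣ T ∪ (I ─ T) ∣                    ≤⟨ p⊆q⇒∣p∣≤∣q∣ (∪-least T⊆I (p─q⊆p I T)) ⟩
      ∣ I ∣                              ∎
      where
      open ≤-Reasoning
      Z : Subset m
      Z = J ─ I
      J⊆ : J ⊆ (J ∩ (T ∪ Z)) ∪ (I ─ T)
      J⊆ {x} x∈J with x ∈? I | x ∈? T
      ... | no x∉I  | _       = p⊆p∪q _ (x∈p∩q⁺ (x∈J , q⊆p∪q T Z (x∈p∧x∉q⇒x∈p─q x∈J x∉I)))
      ... | yes _   | yes x∈T = p⊆p∪q _ (x∈p∩q⁺ (x∈J , p⊆p∪q Z x∈T))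
      ... | yes x∈I | no x∉T  = q⊆p∪q _ _ (x∈p∧x∉q⇒x∈p─q x∈I x∉T)
      disjoint : Empty (T ∩ (I ─ T))
      disjoint (x , x∈) with x∈p∩q⁻ T (I ─ T) x∈
      ... | x∈T , x∈I─T = x∈p─q⇒x∉q I T x∈I─T x∈T

  -- If no y ∈ J ─ I can be added to I, each such y is spanned by a tight subset of I; the union of
  -- these tight sets is tight and spans all of J ─ I, and then the Hall condition for J forces |J| ≤ |I|.
  hall-augment : ∀ {I J} → Hall g I → Hall g J → ∣ I ∣ < ∣ J ∣ →
                 ∃ λ y → y ∈ J × y ∉ I × Hall g (I ∪ ⁅ y ⁆)
  hall-augment {I} {J} I-hall J-hall ∣I∣<∣J∣ with any? (λ y → (y ∈? J ─ I) ×-dec hall? g (I ∪ ⁅ y ⁆))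
  ... | yes (y , y∈J─I , I+y-hall) = y , p─q⊆p J I y∈J─I , x∈p─q⇒x∉q J I y∈J─I , I+y-hall
  ... | no ¬augmentable = contradiction (∣J∣≤∣I∣ J-hall (tight-spanning violators (J ─ I) id)) (<⇒≱ ∣I∣<∣J∣)
    where
    open Augmentation I-hall
    violators : ∀ y → y ∈ J ─ I → Violator g (I ∪ ⁅ y ⁆)
    violators y y∈J─I = [ (λ hall → contradiction (y , y∈J─I , hall) ¬augmentable) , id ]′ (hall-or-violator g _)

  hallMatroid : Matroid m
  hallMatroid = record
    { Indep     = Hall g
    ; indep?    = hall? g
    ; indep-∅   = hall-⊥ g
    ; indep-⊆   = hall-⊆ g
    ; indep-aug = hall-augment
    }

-- Rado's theorem for k-fold unions

module KFoldUnion {m} (M : Matroid m) {ρ : Subset m → ℕ} (isRank : IsRankFunction (Matroid.Indep M) ρ)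
                  (k : ℕ) where
  open Matroid M
  open IsRankFunction isRank
  open MatroidRank M isRank

  IsUnionIndep : Subset m → Set
  IsUnionIndep X = ∃ λ (C : Fin k → Subset m) → (∀ j → Indep (C j)) × (∀ {x} → x ∈ X → ∃ λ j → x ∈ C j)

  -- O j is the set of elements that may still be placed in the j-th independent set.
  Slots : Set
  Slots = Fin k → Subset m

  slotBound : Slots → Subset m → ℕ
  slotBound O A = sum (λ j → ρ (A ∩ O j))

  slotBound-mono : ∀ O → Monotone (slotBound O)
  slotBound-mono O A⊆B = sum-mono-≤ {k} (λ j → rank-mono (∩-greatest (⊆-trans (p∩q⊆p _ _) A⊆B) (p∩q⊆q _ _)))

  slotBound-submodular : ∀ O → Submodular (slotBound O)
  slotBound-submodular O A B = begin
    slotBound O (A ∪ B) + slotBound O (A ∩ B)    ≡⟨ ∑-distrib-+ {k} _ _ ⟨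
    sum (λ j → ρ ((A ∪ B) ∩ O j) + ρ ((A ∩ B) ∩ O j))
      ≤⟨ sum-mono-≤ (λ j → submodular-⊆ rank-mono rank-submodular (∪-part j) (∩-part j)) ⟩
    sum (λ j → ρ (A ∩ O j) + ρ (B ∩ O j))        ≡⟨ ∑-distrib-+ {k} _ _ ⟩
    slotBound O A + slotBound O B                ∎
    where
    open ≤-Reasoning
    ∪-part : ∀ j → (A ∪ B) ∩ O j ⊆ (A ∩ O j) ∪ (B ∩ O j)
    ∪-part j x∈ with x∈p∩q⁻ (A ∪ B) (O j) x∈
    ... | x∈A∪B , x∈Oj = x∈p∪q⁺ (Data.Sum.map (λ x∈A → x∈p∩q⁺ (x∈A , x∈Oj)) (λ x∈B → x∈p∩q⁺ (x∈B , x∈Oj))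
                                               (x∈p∪q⁻ A B x∈A∪B))
    ∩-part : ∀ j → (A ∩ B) ∩ O j ⊆ (A ∩ O j) ∩ (B ∩ O j)
    ∩-part j = ∩-greatest (∩-greatest (⊆-trans (p∩q⊆p _ _) (p∩q⊆p A B)) (p∩q⊆q _ _))
                          (∩-greatest (⊆-trans (p∩q⊆p _ _) (p∩q⊆q A B)) (p∩q⊆q _ _))

  slotBound-⊥ : ∀ O → slotBound O ⊥ ≡ 0
  slotBound-⊥ O = trans (sum-cong-≗ (λ j → trans (cong ρ (∩-zeroˡ (O j))) rank-⊥)) (sum-replicate-zero k)

  allSlots : Slots
  allSlots _ = ⊤

  unionIndep⇒hall : ∀ {X} → IsUnionIndep X → Hall (slotBound allSlots) X
  unionIndep⇒hall (C , C-indep , covered) A A⊆X = begin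
    ∣ A ∣                          ≤⟨ ∣p∣≤∑∣p∩Cj∣ A C (covered ∘ A⊆X) ⟩
    sum (λ j → ∣ A ∩ C j ∣)        ≤⟨ sum-mono-≤ (λ j → indep⇒≤rank (indep-⊆ (p∩q⊆q A (C j)) (C-indep j))
                                                                   (∩-greatest (p∩q⊆p A (C j)) (λ _ → ∈⊤))) ⟩
    slotBound allSlots A           ∎
    where open ≤-Reasoning

  size : Slots → ℕ
  size O = sum (λ j → ∣ O j ∣)

  remove : Slots → Fin m → Fin k → Slots
  remove O x j₀ j = if does (j ≟ j₀) then O j - x else O j

  remove-⊆ : ∀ O x j₀ j → remove O x j₀ j ⊆ O j
  remove-⊆ O x j₀ j with j ≟ j₀
  ... | yes _ = p─q⊆p (O j) ⁅ x ⁆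
  ... | no  _ = id

  ∈-remove : ∀ {O x j₀ y j} → y ∈ O j → y ≢ x ⊎ j ≢ j₀ → y ∈ remove O x j₀ j
  ∈-remove {O} {x} {j₀} {y} {j} y∈Oj y≢x⊎j≢j₀ with j ≟ j₀
  ... | no  _    = y∈Oj
  ... | yes j≡j₀ = [ x∈p∧x≢y⇒x∈p-y y∈Oj , (λ j≢j₀ → contradiction j≡j₀ j≢j₀) ]′ y≢x⊎j≢j₀

  size-remove : ∀ {O x j₀} → x ∈ O j₀ → size (remove O x j₀) < size O
  size-remove {O} {x} {j₀} x∈Oj₀ = sum-mono-< (λ j → p⊆q⇒∣p∣≤∣q∣ (remove-⊆ O x j₀ j)) j₀ shrinks
    where
    shrinks : ∣ remove O x j₀ j₀ ∣ < ∣ O j₀ ∣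
    shrinks with j₀ ≟ j₀
    ... | yes _    = x∈p⇒∣p-x∣<∣p∣ x∈Oj₀
    ... | no j₀≢j₀ = contradiction refl j₀≢j₀

  module _ {O : Slots} {I : Subset m} (I-hall : Hall (slotBound O) I) where

    removal-violator-contains : ∀ {x j₀ A} → A ⊆ I → slotBound (remove O x j₀) A < ∣ A ∣ → x ∈ A
    removal-violator-contains {x} {j₀} {A} A⊆I violates with x ∈? A
    ... | yes x∈A = x∈A
    ... | no  x∉A = contradiction (≤-trans (I-hall A A⊆I) (sum-mono-≤ (λ j → rank-mono (A∩Oj⊆ j)))) (<⇒≱ violates)
      where
      A∩Oj⊆ : ∀ j → A ∩ O j ⊆ A ∩ remove O x j₀ j
      A∩Oj⊆ j y∈ with x∈p∩q⁻ A (O j) y∈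
      ... | y∈A , y∈Oj = x∈p∩q⁺ (y∈A , ∈-remove {O} {x} {j₀} y∈Oj (inj₁ (λ { refl → x∉A y∈A })))

    removals-not-both-violate : ∀ {x j₁ j₂} → j₁ ≢ j₂ →
      Violator (slotBound (remove O x j₁)) I → ¬ Violator (slotBound (remove O x j₂)) I
    removals-not-both-violate {x} {j₁} {j₂} j₁≢j₂ (A₁ , A₁⊆I , A₁-violates) (A₂ , A₂⊆I , A₂-violates) =
      contradiction (∣p∪q∣+∣p∩q∣≡∣p∣+∣q∣ A₁ A₂) (<⇒≢ (begin
        suc (∣ A₁ ∪ A₂ ∣ + ∣ A₁ ∩ A₂ ∣)                ≤⟨ s≤s (+-monoʳ-≤ ∣ A₁ ∪ A₂ ∣ (∣p∣≤1+∣p-x∣ (A₁ ∩ A₂) x)) ⟩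
        suc (∣ A₁ ∪ A₂ ∣ + suc ∣ Q ∣)                  ≡⟨ cong suc (+-suc _ _) ⟩
        suc (suc (∣ A₁ ∪ A₂ ∣ + ∣ Q ∣))                ≤⟨ s≤s (s≤s (+-mono-≤ (I-hall _ A₁∪A₂⊆I) (I-hall Q Q⊆I))) ⟩
        suc (suc (slotBound O (A₁ ∪ A₂) + slotBound O Q)) ≤⟨ s≤s (s≤s submodular-sum) ⟩
        suc (suc (slotBound O₁ A₁ + slotBound O₂ A₂))  ≡⟨ cong suc (+-suc _ _) ⟨
        suc (slotBound O₁ A₁) + suc (slotBound O₂ A₂)  ≤⟨ +-mono-≤ A₁-violates A₂-violates ⟩
        ∣ A₁ ∣ + ∣ A₂ ∣                                ∎))
      where
      open ≤-Reasoning
      O₁ O₂ : Slots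
      O₁ = remove O x j₁
      O₂ = remove O x j₂
      Q : Subset m
      Q = (A₁ ∩ A₂) - x
      A₁∪A₂⊆I : A₁ ∪ A₂ ⊆ I
      A₁∪A₂⊆I = ∪-least A₁⊆I A₂⊆I
      Q⊆I : Q ⊆ I
      Q⊆I = ⊆-trans (p─q⊆p _ _) (⊆-trans (p∩q⊆p A₁ A₂) A₁⊆I)
      x∈A₁ : x ∈ A₁
      x∈A₁ = removal-violator-contains A₁⊆I A₁-violates
      x∈A₂ : x ∈ A₂
      x∈A₂ = removal-violator-contains A₂⊆I A₂-violates
      ∪-part : ∀ j → (A₁ ∪ A₂) ∩ O j ⊆ (A₁ ∩ O₁ j) ∪ (A₂ ∩ O₂ j)
      ∪-part j {y} y∈ with x∈p∩q⁻ (A₁ ∪ A₂) (O j) y∈ | toSum (y ≟ x) | toSum (j ≟ j₁)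
      ... | y∈A₁∪A₂ , y∈Oj | inj₂ y≢x | _ =
            x∈p∪q⁺ (Data.Sum.map (λ y∈A₁ → x∈p∩q⁺ (y∈A₁ , ∈-remove {O} {x} {j₁} y∈Oj (inj₁ y≢x)))
                                 (λ y∈A₂ → x∈p∩q⁺ (y∈A₂ , ∈-remove {O} {x} {j₂} y∈Oj (inj₁ y≢x)))
                                 (x∈p∪q⁻ A₁ A₂ y∈A₁∪A₂))
      ... | _ , y∈Oj | inj₁ refl | inj₂ j≢j₁ = p⊆p∪q _ (x∈p∩q⁺ (x∈A₁ , ∈-remove {O} {x} {j₁} y∈Oj (inj₂ j≢j₁)))
      ... | _ , y∈Oj | inj₁ refl | inj₁ refl = q⊆p∪q _ _ (x∈p∩q⁺ (x∈A₂ , ∈-remove {O} {x} {j₂} y∈Oj (inj₂ j₁≢j₂)))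
      ∩-part : ∀ j → Q ∩ O j ⊆ (A₁ ∩ O₁ j) ∩ (A₂ ∩ O₂ j)
      ∩-part j y∈ with x∈p∩q⁻ Q (O j) y∈
      ... | y∈Q , y∈Oj with x∈p∩q⁻ A₁ A₂ (p─q⊆p _ _ y∈Q)
      ...   | y∈A₁ , y∈A₂ = x∈p∩q⁺ (x∈p∩q⁺ (y∈A₁ , ∈-remove {O} {x} {j₁} y∈Oj (inj₁ y≢x)) ,
                                    x∈p∩q⁺ (y∈A₂ , ∈-remove {O} {x} {j₂} y∈Oj (inj₁ y≢x)))
        where
        y≢x : _ ≢ x
        y≢x refl = x∈p─q⇒x∉q _ ⁅ x ⁆ y∈Q (x∈⁅x⁆ x)
      submodular-sum : slotBound O (A₁ ∪ A₂) + slotBound O Q ≤ slotBound O₁ A₁ + slotBound O₂ A₂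
      submodular-sum = begin
        slotBound O (A₁ ∪ A₂) + slotBound O Q          ≡⟨ ∑-distrib-+ {k} _ _ ⟨
        sum (λ j → ρ ((A₁ ∪ A₂) ∩ O j) + ρ (Q ∩ O j))
          ≤⟨ sum-mono-≤ (λ j → submodular-⊆ rank-mono rank-submodular (∪-part j) (∩-part j)) ⟩
        sum (λ j → ρ (A₁ ∩ O₁ j) + ρ (A₂ ∩ O₂ j))      ≡⟨ ∑-distrib-+ {k} _ _ ⟩
        slotBound O₁ A₁ + slotBound O₂ A₂              ∎

    unambiguous⇒unionIndep : (∀ {x j j′} → x ∈ I → x ∈ O j → x ∈ O j′ → j ≡ j′) → IsUnionIndep I
    unambiguous⇒unionIndep unambiguous = C , C-indep , covered
      where
      C : Fin k → Subset m
      C j = I ∩ O j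
      C⊆I : ∀ j → C j ⊆ I
      C⊆I j = p∩q⊆p I (O j)
      C-indep : ∀ j → Indep (C j)
      C-indep j = ∣S∣≤rank⇒indep (begin
        ∣ C j ∣                      ≤⟨ I-hall (C j) (C⊆I j) ⟩
        slotBound O (C j)            ≡⟨ sum-single _ j (λ j′ j′≢j → n≤0⇒n≡0 (≤-trans (rank≤∣S∣ _)
                                          (≤-reflexive (Empty⇒∣p∣≡0 (others-empty j′ j′≢j))))) ⟩
        ρ (C j ∩ O j)                ≤⟨ rank-mono (p∩q⊆p (C j) (O j)) ⟩
        ρ (C j)                      ∎)
        where
        open ≤-Reasoning
        others-empty : ∀ j′ → j′ ≢ j → Empty (C j ∩ O j′)
        others-empty j′ j′≢j (x , x∈) with x∈p∩q⁻ (C j) (O j′) x∈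
        ... | x∈Cj , x∈Oj′ with x∈p∩q⁻ I (O j) x∈Cj
        ...   | x∈I , x∈Oj = j′≢j (unambiguous x∈I x∈Oj′ x∈Oj)
      covered : ∀ {x} → x ∈ I → ∃ λ j → x ∈ C j
      covered {x} x∈I with 0<sum⇒∃0<term _ (≤-trans (≤-reflexive (sym (∣⁅x⁆∣≡1 x))) (I-hall ⁅ x ⁆ (x∈p⇒⁅x⁆⊆p x∈I)))
      ... | j , 0<ρ with 0<∣p∣⇒Nonempty (⁅ x ⁆ ∩ O j) (≤-trans 0<ρ (rank≤∣S∣ _))
      ... | y , y∈ with x∈p∩q⁻ ⁅ x ⁆ (O j) y∈
      ... | y∈⁅x⁆ , y∈Oj rewrite x∈⁅y⁆⇒x≡y x y∈⁅x⁆ = j , x∈p∩q⁺ (x∈I , y∈Oj)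

  -- Induction on the number of admissible (element, slot) pairs: while some element of I has two
  -- slots, removing one of them preserves the Hall condition; once every element has a single slot,
  -- the slots themselves are the independent sets.
  hall⇒unionIndep : ∀ {I} O → Hall (slotBound O) I → IsUnionIndep I
  hall⇒unionIndep {I} O = go O (<-wellFounded (size O))
    where
    go : ∀ O → Acc _<_ (size O) → Hall (slotBound O) I → IsUnionIndep I
    go O (acc smaller) I-hall
      with any? (λ x → any? (λ j₁ → any? (λ j₂ → (x ∈? I) ×-dec (x ∈? O j₁) ×-dec (x ∈? O j₂) ×-dec ¬? (j₁ ≟ j₂))))
    ... | no ¬ambiguous = unambiguous⇒unionIndep I-hall (λ {x} {j} {j′} x∈I x∈Oj x∈Oj′ →
            decidable-stable (j ≟ j′) (λ j≢j′ → ¬ambiguous (x , j , j′ , x∈I , x∈Oj , x∈Oj′ , j≢j′)))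
    ... | yes (x , j₁ , j₂ , x∈I , x∈Oj₁ , x∈Oj₂ , j₁≢j₂)
      with hall-or-violator (slotBound (remove O x j₁)) I | hall-or-violator (slotBound (remove O x j₂)) I
    ... | inj₁ hall₁ | _         = go (remove O x j₁) (smaller (size-remove x∈Oj₁)) hall₁
    ... | inj₂ _     | inj₁ hall₂ = go (remove O x j₂) (smaller (size-remove x∈Oj₂)) hall₂
    ... | inj₂ viol₁ | inj₂ viol₂ = ⊥-elim (removals-not-both-violate I-hall j₁≢j₂ viol₁ viol₂)

  unionIndep⇔hall : ∀ X → IsUnionIndep X ⇔ Hall (slotBound allSlots) X
  unionIndep⇔hall X = mk⇔ unionIndep⇒hall (hall⇒unionIndep allSlots)

  unionMatroid : Matroid m
  unionMatroid = HallMatroid.hallMatroid (slotBound allSlots) (slotBound-mono allSlots)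
                                         (slotBound-submodular allSlots) (slotBound-⊥ allSlots)

T-does⇔ : ∀ {A : Set} (a? : Dec A) → T (does a?) ⇔ A
T-does⇔ (yes a) = mk⇔ (λ _ → a) (λ _ → tt)
T-does⇔ (no ¬a) = mk⇔ (λ ()) ¬a

inB-reflects : ∀ {m} (x : Fin m) (X : Subset m) → T (inB x X) ⇔ x ∈ X
inB-reflects x X = T-does⇔ (x ∈? X)

inB-tabulate : ∀ {m} (b : Fin m → Bool) x → inB x (tabulate (λ y → if b y then inside else outside)) ≡ b x
inB-tabulate b zero with b zero
... | true  = refl
... | false = refl
inB-tabulate b (suc x) = inB-tabulate (b ∘ suc) x

T-allFin : ∀ {k} (f : Fin k → Bool) → T (allFin f) ⇔ (∀ i → T (f i))
T-allFin {zero}  f = mk⇔ (λ _ ()) (λ _ → tt)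
T-allFin {suc k} f = mk⇔
  (λ all → let (f₀ , rest) = to T-∧ all in
           λ { zero → f₀ ; (suc i) → to (T-allFin (f ∘ suc)) rest i })
  (λ all → from T-∧ (all zero , from (T-allFin (f ∘ suc)) (all ∘ suc)))

T-anyFin : ∀ {k} (f : Fin k → Bool) → T (anyFin f) ⇔ ∃ λ i → T (f i)
T-anyFin {zero}  f = mk⇔ (λ ()) (λ ())
T-anyFin {suc k} f with f zero in f₀≡
... | true  = mk⇔ (λ _ → zero , subst T (sym f₀≡) tt) (λ _ → tt)
... | false = mk⇔ (λ some → let (i , fi) = to (T-anyFin (f ∘ suc)) some in suc i , fi)
                  (λ { (zero , f₀) → contradiction (subst T f₀≡ f₀) id
                     ; (suc i , fi) → from (T-anyFin (f ∘ suc)) (i , fi) })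

indicator : Bool → ℕ
indicator b = if b then 1 else 0

countFin≡sum : ∀ {k} (f : Fin k → Bool) → countFin f ≡ sum (indicator ∘ f)
countFin≡sum {zero}  f = refl
countFin≡sum {suc k} f = cong (indicator (f zero) +_) (countFin≡sum (f ∘ suc))

countFin-↑ : ∀ a {b} (f : Fin (a + b) → Bool) →
             countFin f ≡ countFin (λ i → f (i ↑ˡ b)) + countFin (λ j → f (a ↑ʳ j))
countFin-↑ zero    f = refl
countFin-↑ (suc a) {b} f = trans (cong (indicator (f zero) +_) (countFin-↑ a (f ∘ suc)))
  (sym (+-assoc (indicator (f zero)) (countFin (λ i → f (suc i ↑ˡ b))) (countFin (λ j → f (suc a ↑ʳ j)))))

countFin-combine : ∀ n {k} (f : Fin (n * k) → Bool) → countFin f ≡ sum {n} (λ e → countFin {k} (λ i → f (combine e i)))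
countFin-combine zero    f = refl
countFin-combine (suc n) {k} f = trans (countFin-↑ k f) (cong (countFin (λ i → f (i ↑ˡ n * k)) +_)
                                                          (countFin-combine n (λ x → f (k ↑ʳ x))))

∣p∣≡countFin : ∀ {m} (p : Subset m) → ∣ p ∣ ≡ countFin (λ x → inB x p)
∣p∣≡countFin []            = refl
∣p∣≡countFin (inside  ∷ p) = cong suc (∣p∣≡countFin p)
∣p∣≡countFin (outside ∷ p) = ∣p∣≡countFin p

T⇒0<countFin : ∀ {k} (f : Fin k → Bool) i → T (f i) → 0 < countFin f
T⇒0<countFin f zero fi with f zero
... | true = s≤s z≤n
T⇒0<countFin f (suc i) fi = ≤-trans (T⇒0<countFin (f ∘ suc) i fi) (m≤n+m _ (indicator (f zero)))

countFin≡0 : ∀ {k} (f : Fin k → Bool) → (∀ i → ¬ T (f i)) → countFin f ≡ 0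
countFin≡0 {zero}  f none = refl
countFin≡0 {suc k} f none with f zero | none zero
... | false | _   = countFin≡0 (f ∘ suc) (none ∘ suc)
... | true  | ¬f₀ = contradiction tt ¬f₀

Unique : ∀ {k} → (Fin k → Bool) → Set
Unique f = ∀ i i′ → T (f i) → T (f i′) → i ≡ i′

countFin≤1⇔unique : ∀ {k} (f : Fin k → Bool) → countFin f ≤ 1 ⇔ Unique f
countFin≤1⇔unique {zero}  f = mk⇔ (λ _ i → ⊥-elim (Finₚ.¬Fin0 i)) (λ _ → z≤n)
countFin≤1⇔unique {suc k} f with f zero in f₀≡
... | true  = mk⇔ (λ ≤1 → unique-head (λ i fi → <⇒≱ (T⇒0<countFin (f ∘ suc) i fi) (s≤s⁻¹ ≤1))) tail-empty
  where
  unique-head : (∀ i → ¬ T (f (suc i))) → Unique f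
  unique-head none zero    zero     _  _   = refl
  unique-head none zero    (suc i′) _  fi′ = contradiction fi′ (none i′)
  unique-head none (suc i) _        fi _   = contradiction fi (none i)
  tail-empty : Unique f → suc (countFin (f ∘ suc)) ≤ 1
  tail-empty unique = ≤-reflexive (cong suc (countFin≡0 (f ∘ suc)
    (λ i fi → contradiction (unique zero (suc i) (subst T (sym f₀≡) tt) fi) λ ())))
... | false = mk⇔ (λ ≤1 → unique-tail (to (countFin≤1⇔unique (f ∘ suc)) ≤1))
                  (λ unique → from (countFin≤1⇔unique (f ∘ suc))
                                (λ i i′ fi fi′ → Finₚ.suc-injective (unique (suc i) (suc i′) fi fi′)))
  where
  unique-tail : Unique (f ∘ suc) → Unique f
  unique-tail _      zero    _        f₀ _   = contradiction (subst T f₀≡ f₀) id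
  unique-tail _      (suc _) zero     _  f₀  = contradiction (subst T f₀≡ f₀) id
  unique-tail unique (suc i) (suc i′) fi fi′ = cong suc (unique i i′ fi fi′)

countFin≤1⇒countFin≡anyFin : ∀ {k} (f : Fin k → Bool) → countFin f ≤ 1 → countFin f ≡ indicator (anyFin f)
countFin≤1⇒countFin≡anyFin {zero}  f ≤1 = refl
countFin≤1⇒countFin≡anyFin {suc k} f ≤1 with f zero
... | true  = cong suc (n≤0⇒n≡0 (s≤s⁻¹ ≤1))
... | false = countFin≤1⇒countFin≡anyFin (f ∘ suc) ≤1

-- The extended matroid M_* and the rank of M^k_*

module StarMatroid {n} (M : Matroid n) (k : ℕ) where
  open Matroid M
  open Extended M k

  copies : Fin n → Subset (n * k) → Fin k → Bool
  copies e X i = inB (pair e i) X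

  ∈-proj⁻ : ∀ {e X} → e ∈ proj X → ∃ λ i → pair e i ∈ X
  ∈-proj⁻ {e} {X} e∈projX with to (T-anyFin (copies e X))
    (subst T (inB-tabulate (λ e → anyFin (copies e X)) e) (from (inB-reflects e (proj X)) e∈projX))
  ... | i , copy = i , to (inB-reflects (pair e i) X) copy

  ∈-proj⁺ : ∀ {e i X} → pair e i ∈ X → e ∈ proj X
  ∈-proj⁺ {e} {i} {X} pair∈X = to (inB-reflects e (proj X))
    (subst T (sym (inB-tabulate (λ e → anyFin (copies e X)) e))
      (from (T-anyFin (copies e X)) (i , from (inB-reflects (pair e i) X) pair∈X)))

  proj-mono : ∀ {X Y} → X ⊆ Y → proj X ⊆ proj Y
  proj-mono X⊆Y e∈projX with ∈-proj⁻ e∈projX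
  ... | i , pair∈X = ∈-proj⁺ (X⊆Y pair∈X)

  AtMostOneCopy : Subset (n * k) → Set
  AtMostOneCopy X = ∀ e i i′ → pair e i ∈ X → pair e i′ ∈ X → i ≡ i′

  atMostOneCopy⇔unique : ∀ X → AtMostOneCopy X ⇔ (∀ e → Unique (copies e X))
  atMostOneCopy⇔unique X = mk⇔
    (λ few e i i′ ci ci′ → few e i i′ (to (inB-reflects _ X) ci) (to (inB-reflects _ X) ci′))
    (λ unique e i i′ p∈ p′∈ → unique e i i′ (from (inB-reflects _ X) p∈) (from (inB-reflects _ X) p′∈))

  Indep* : Subset (n * k) → Set
  Indep* X = AtMostOneCopy X × Indep (proj X)

  indep*B-reflects : ∀ X → T (indep*B X) ⇔ Indep* X
  indep*B-reflects X = mk⇔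
    (λ indep → let (few , proj-indep) = to T-∧ indep in
      from (atMostOneCopy⇔unique X) (λ e → to (countFin≤1⇔unique (copies e X))
               (to (T-does⇔ (_ ≤? 1)) (to (T-allFin _) few e))) ,
      to (T-does⇔ (indep? (proj X))) proj-indep)
    (λ (few , proj-indep) → from T-∧
      (from (T-allFin _) (λ e → from (T-does⇔ (_ ≤? 1))
                                         (from (countFin≤1⇔unique (copies e X))
                                           (to (atMostOneCopy⇔unique X) few e))) ,
       from (T-does⇔ (indep? (proj X))) proj-indep))

  ∣X∣≡∣projX∣ : ∀ {X} → AtMostOneCopy X → ∣ X ∣ ≡ ∣ proj X ∣
  ∣X∣≡∣projX∣ {X} few = begin
    ∣ X ∣                                              ≡⟨ ∣p∣≡countFin X ⟩
    countFin (λ x → inB x X)                           ≡⟨ countFin-combine n _ ⟩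
    sum (λ e → countFin (copies e X))                  ≡⟨ sum-cong-≗ one-or-none ⟩
    sum (λ e → indicator (anyFin (copies e X)))
      ≡⟨ sum-cong-≗ (cong indicator ∘ inB-tabulate (λ e → anyFin (copies e X))) ⟨
    sum (λ e → indicator (inB e (proj X)))             ≡⟨ countFin≡sum (λ e → inB e (proj X)) ⟨
    countFin (λ e → inB e (proj X))                    ≡⟨ ∣p∣≡countFin (proj X) ⟨
    ∣ proj X ∣                                         ∎
    where
    open ≡-Reasoning
    one-or-none : ∀ e → countFin (copies e X) ≡ indicator (anyFin (copies e X))
    one-or-none e = countFin≤1⇒countFin≡anyFin (copies e X) (from (countFin≤1⇔unique (copies e X))
                                                              (to (atMostOneCopy⇔unique X) few e))

  indep*-⊥ : Indep* ⊥
  indep*-⊥ = (λ _ _ _ p∈⊥ → ⊥-elim (∉⊥ p∈⊥)) , indep-⊆ (λ e∈ → ⊥-elim (∉⊥ (proj₂ (∈-proj⁻ e∈)))) indep-∅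

  indep*-⊆ : ∀ {X Y} → X ⊆ Y → Indep* Y → Indep* X
  indep*-⊆ X⊆Y (Y-few , Y-indep) = (λ e i i′ p∈ p′∈ → Y-few e i i′ (X⊆Y p∈) (X⊆Y p′∈)) , indep-⊆ (proj-mono X⊆Y) Y-indep

  indep*-aug : ∀ {X Y} → Indep* X → Indep* Y → ∣ X ∣ < ∣ Y ∣ → ∃ λ y → y ∈ Y × y ∉ X × Indep* (X ∪ ⁅ y ⁆)
  indep*-aug {X} {Y} (X-few , X-indep) (Y-few , Y-indep) ∣X∣<∣Y∣
    with indep-aug X-indep Y-indep (subst₂ _<_ (∣X∣≡∣projX∣ X-few) (∣X∣≡∣projX∣ Y-few) ∣X∣<∣Y∣)
  ... | e , e∈projY , e∉projX , projX+e-indep with ∈-proj⁻ e∈projY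
  ... | i , pair∈Y = pair e i , pair∈Y , e∉projX ∘ ∈-proj⁺ , X+y-few , indep-⊆ proj⊆ projX+e-indep
    where
    y : E*
    y = pair e i
    in-X-or-y : ∀ {e′ i′} → pair e′ i′ ∈ X ∪ ⁅ y ⁆ → pair e′ i′ ∈ X ⊎ (e′ ≡ e × i′ ≡ i)
    in-X-or-y p∈ = Data.Sum.map₂ (λ p∈⁅y⁆ → combine-injective _ _ _ _ (x∈⁅y⁆⇒x≡y _ p∈⁅y⁆)) (x∈p∪q⁻ X ⁅ y ⁆ p∈)
    X+y-few : AtMostOneCopy (X ∪ ⁅ y ⁆)
    X+y-few e′ i₁ i₂ p₁∈ p₂∈ with in-X-or-y p₁∈ | in-X-or-y p₂∈
    ... | inj₁ p₁∈X       | inj₁ p₂∈X       = X-few e′ i₁ i₂ p₁∈X p₂∈X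
    ... | inj₁ p₁∈X       | inj₂ (refl , _) = contradiction (∈-proj⁺ p₁∈X) e∉projX
    ... | inj₂ (refl , _) | inj₁ p₂∈X       = contradiction (∈-proj⁺ p₂∈X) e∉projX
    ... | inj₂ (_ , refl) | inj₂ (_ , refl) = refl
    proj⊆ : proj (X ∪ ⁅ y ⁆) ⊆ proj X ∪ ⁅ e ⁆
    proj⊆ e′∈ with ∈-proj⁻ e′∈
    ... | i′ , p∈ with in-X-or-y p∈
    ...   | inj₁ p∈X        = p⊆p∪q _ (∈-proj⁺ p∈X)
    ...   | inj₂ (refl , _) = q⊆p∪q _ _ (x∈⁅x⁆ e)

  starMatroid : Matroid (n * k)
  starMatroid = record
    { Indep     = Indep*
    ; indep?    = λ X → Decidable.map (indep*B-reflects X) (T? (indep*B X))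
    ; indep-∅   = indep*-⊥
    ; indep-⊆   = indep*-⊆
    ; indep-aug = indep*-aug
    }

module UnionRank {n} (M : Matroid n) (k : ℕ) where
  open Extended M k
  open StarMatroid M k

  allSubsets-complete : ∀ m (X : Subset m) → X ∈ₗ allSubsets m
  allSubsets-complete zero    []            = Any.here refl
  allSubsets-complete (suc m) (outside ∷ X) =
    ∈-concatMap⁺ _ (lose (allSubsets-complete m X) (Any.here refl))
  allSubsets-complete (suc m) (inside  ∷ X) =
    ∈-concatMap⁺ _ (lose (allSubsets-complete m X) (Any.there (Any.here refl)))

  tuples-complete : ∀ {A : Set} {xs : List A} → (∀ x → x ∈ₗ xs) → ∀ j (v : Vec A j) → v ∈ₗ tuples xs j
  tuples-complete complete zero    []      = Any.here refl
  tuples-complete complete (suc j) (x ∷ v) =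
    ∈-concatMap⁺ _ (lose (complete x) (∈-map⁺ (x ∷_) (tuples-complete complete j v)))

  T-allV : ∀ {j} (p : Subset (n * k) → Bool) (Is : Vec (Subset (n * k)) j) →
           T (allV p Is) ⇔ (∀ i → T (p (lookup Is i)))
  T-allV p []       = mk⇔ (λ _ ()) (λ _ → tt)
  T-allV p (I ∷ Is) = mk⇔
    (λ all → let (pI , rest) = to T-∧ all in
             λ { zero → pI ; (suc i) → to (T-allV p Is) rest i })
    (λ all → from T-∧ (all zero , from (T-allV p Is) (all ∘ suc)))

  ∈-unionAll⁻ : ∀ {j x} (Is : Vec (Subset (n * k)) j) → x ∈ unionAll Is → ∃ λ i → x ∈ lookup Is i
  ∈-unionAll⁻ []       x∈ = ⊥-elim (∉⊥ x∈)
  ∈-unionAll⁻ (I ∷ Is) x∈ with x∈p∪q⁻ I (unionAll Is) x∈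
  ... | inj₁ x∈I = zero , x∈I
  ... | inj₂ x∈⋃ with ∈-unionAll⁻ Is x∈⋃
  ...   | i , x∈Ii = suc i , x∈Ii

  ∈-unionAll⁺ : ∀ {j x} (Is : Vec (Subset (n * k)) j) i → x ∈ lookup Is i → x ∈ unionAll Is
  ∈-unionAll⁺ (I ∷ Is) zero    x∈I  = p⊆p∪q _ x∈I
  ∈-unionAll⁺ (I ∷ Is) (suc i) x∈Ii = q⊆p∪q I _ (∈-unionAll⁺ Is i x∈Ii)

  rank* : Subset (n * k) → ℕ
  rank* = maxSize indep*B (allSubsets (n * k))

  rank*-isRank : IsRankFunction Indep* rank*
  rank*-isRank = maxSize-isRank indep*B-reflects indep*-⊥ (allSubsets-complete (n * k))

  open KFoldUnion starMatroid rank*-isRank k using (IsUnionIndep; unionIndep⇔hall; unionMatroid)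

  indepUnionB-reflects : ∀ X → T (indepUnionB X) ⇔ IsUnionIndep X
  indepUnionB-reflects X = mk⇔ ⇒unionIndep unionIndep⇒
    where
    ⇒unionIndep : T (indepUnionB X) → IsUnionIndep X
    ⇒unionIndep indep with Any.satisfied (any⁻ _ (tuples (allSubsets (n * k)) k) indep)
    ... | Is , all∧≡ with to T-∧ all∧≡
    ...   | all , ≡X = lookup Is , (λ i → to (indep*B-reflects _) (to (T-allV indep*B Is) all i)) ,
                       λ x∈X → ∈-unionAll⁻ Is (subst (_ ∈_) (sym (to (T-does⇔ (Vecₚ.≡-dec Boolₚ._≟_ _ X)) ≡X)) x∈X)
    unionIndep⇒ : IsUnionIndep X → T (indepUnionB X)
    unionIndep⇒ (C , C-indep , covered) = any⁺ _ (lose (tuples-complete (allSubsets-complete (n * k)) k Is)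
      (from T-∧ (from (T-allV indep*B Is) Is-indep , from (T-does⇔ (Vecₚ.≡-dec Boolₚ._≟_ _ X)) ⋃Is≡X)))
      where
      Is : Vec (Subset (n * k)) k
      Is = tabulate (λ j → C j ∩ X)
      Is-indep : ∀ i → T (indep*B (lookup Is i))
      Is-indep i = from (indep*B-reflects _)
                     (subst Indep* (sym (lookup∘tabulate _ i)) (indep*-⊆ (p∩q⊆p (C i) X) (C-indep i)))
      ⋃Is≡X : unionAll Is ≡ X
      ⋃Is≡X = ⊆-antisym
        (λ x∈ → let (i , x∈Ii) = ∈-unionAll⁻ Is x∈ in p∩q⊆q (C i) X (subst (_ ∈_) (lookup∘tabulate _ i) x∈Ii))
        (λ x∈X → let (i , x∈Ci) = covered x∈X in
                 ∈-unionAll⁺ Is i (subst (_ ∈_) (sym (lookup∘tabulate _ i)) (x∈p∩q⁺ (x∈Ci , x∈X))))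

  rank-isRank : IsRankFunction (Matroid.Indep unionMatroid) rank
  rank-isRank = maxSize-isRank (λ X → ⇔-trans (indepUnionB-reflects X) (unionIndep⇔hall X))
                               (hall-⊥ _) (allSubsets-complete (n * k))

  open MatroidRank unionMatroid rank-isRank public

-- Occupancy

[k+s]∸x≤[k+t]∸y+d : ∀ k {s t x y} d → y + s ≤ x + (t + d) → (k + s) ∸ x ≤ (k + t) ∸ y + d
[k+s]∸x≤[k+t]∸y+d k {s} {t} {x} {y} d y+s≤ = m≤n+o⇒m∸n≤o (k + s) x (+-cancelˡ-≤ y _ _ (begin
  y + (k + s)                    ≡⟨ x∙yz≈y∙xz y k s ⟩
  k + (y + s)                    ≤⟨ +-monoʳ-≤ k y+s≤ ⟩
  k + (x + (t + d))              ≡⟨ x∙yz≈y∙xz k x (t + d) ⟩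
  x + (k + (t + d))              ≡⟨ cong (x +_) (+-assoc k t d) ⟨
  x + ((k + t) + d)              ≤⟨ +-monoʳ-≤ x (+-monoˡ-≤ d (m≤n+m∸n (k + t) y)) ⟩
  x + ((y + ((k + t) ∸ y)) + d)  ≡⟨ cong (x +_) (+-assoc y _ d) ⟩
  x + (y + ((k + t) ∸ y + d))    ≡⟨ x∙yz≈y∙xz x y _ ⟩
  y + (x + ((k + t) ∸ y + d))    ∎))
  where open ≤-Reasoning

module _ {n} (M : Matroid n) (k : ℕ) (e : Fin n) where
  open Extended M k
  open UnionRank M k

  occ-mono : ∀ S S′ → S ⊆ S′ → occ e S ≤ occ e S′
  occ-mono S S′ S⊆S′ = subst ((k + rank S) ∸ rank (S ∪ fiber e) ≤_) (+-identityʳ _)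
    ([k+s]∸x≤[k+t]∸y+d k {rank S} {rank S′} {rank (S ∪ fiber e)} {rank (S′ ∪ fiber e)} 0 (begin
    rank (S′ ∪ fiber e) + rank S     ≤⟨ submodular-⊆ rank-mono rank-submodular
                                          (∪-least (q⊆p∪q _ S′) (⊆-trans (q⊆p∪q S (fiber e)) (p⊆p∪q S′)))
                                          (∩-greatest (p⊆p∪q (fiber e)) S⊆S′) ⟩
    rank (S ∪ fiber e) + rank S′     ≡⟨ cong (rank (S ∪ fiber e) +_) (+-identityʳ _) ⟨
    rank (S ∪ fiber e) + (rank S′ + 0) ∎))
    where open ≤-Reasoning

  occ-lipschitz : ∀ S a → occ e (S ∪ ⁅ a ⁆) ∸ occ e S ≤ 1
  occ-lipschitz S a = m≤n+o⇒m∸n≤o _ (occ e S)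
    ([k+s]∸x≤[k+t]∸y+d k {rank (S ∪ ⁅ a ⁆)} {rank S} {rank ((S ∪ ⁅ a ⁆) ∪ fiber e)} {rank (S ∪ fiber e)} 1 (begin
    rank (S ∪ fiber e) + rank (S ∪ ⁅ a ⁆)        ≤⟨ +-mono-≤ (rank-mono S∪F⊆) (rank-∪⁅x⁆ S a) ⟩
    rank ((S ∪ ⁅ a ⁆) ∪ fiber e) + suc (rank S)  ≡⟨ cong (rank ((S ∪ ⁅ a ⁆) ∪ fiber e) +_) (+-comm 1 (rank S)) ⟩
    rank ((S ∪ ⁅ a ⁆) ∪ fiber e) + (rank S + 1)  ∎))
    where
    open ≤-Reasoning
    S∪F⊆ : S ∪ fiber e ⊆ (S ∪ ⁅ a ⁆) ∪ fiber e
    S∪F⊆ = ∪-least (⊆-trans (p⊆p∪q ⁅ a ⁆) (p⊆p∪q (fiber e))) (q⊆p∪q _ _)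

lemma4p7 : {n : ℕ} (M : Matroid n) (k : ℕ) (e : Fin n) (i : Fin k) →
    let open Extended M k in
    (∀ (S T : Subset (n Data.Nat.* k)) → S ⊆ T → occ e S ≤ occ e T)
    × (∀ (S : Subset (n Data.Nat.* k)) (a : E*) → occ e (S ∪ ⁅ a ⁆) ∸ occ e S ≤ 1)
-- occ_e does not depend on the copy index i.
lemma4p7 M k e _ = occ-mono M k e , occ-lipschitz M k e
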